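{- Let $G$ be a finite simple graph with no even cycles. If $e=vw$ is an edge of $G$, then $p(G;z)=p(G\setminus e;z)+z\,p(G-\{v,w\};z)$. Moreover, if $v$ is a vertex of $G$ with neighbors $w_1,\dots,w_r$, then $p(G;z)=p(G-v;z)+z\sum_{i=1}^r p(G-\{v,w_i\};z)$.
   Context: A perfectly matchable set of a graph $G$ is a subset $S\subseteq V(G)$ such that the induced subgraph $G[S]$ has a perfect matching; the empty set counts as one. The perfectly matchable set polynomial is $p(G;z)=\sum_{k\ge0}p_{2k}z^k$, where $p_{2k}$ is the number of perfectly matchable sets of $G$ of size $2k$. $G\setminus e$ denotes deletion of the edge $e$; $G-v$ and $G-\{v,w\}$ denote deletion of vertices. -}

module Defs where

open import Data.Nat using (ℕ; zero; suc; _+_; _*_; _≤_)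
open import Data.Nat.Properties using () renaming (_≟_ to _≟ℕ_)
open import Data.Bool using (Bool; true; false; _∧_; _∨_; not)
open import Data.Bool.Properties using () renaming (_≟_ to _≟B_)
open import Data.Fin using (Fin; zero; suc; inject₁; fromℕ) renaming (_≟_ to _≟F_)
open import Data.Fin.Subset using (Subset; _∈_; _⊆_; _-_; ∣_∣)
open import Data.Fin.Subset.Properties using (_∈?_; _⊆?_)
open import Data.Fin.Properties using (any?; all?)
open import Data.Vec using (Vec; []; _∷_; lookup)
open import Data.List using (List; []; _∷_; _++_; map; filter; length; allFin)
open import Data.Nat.ListAction using (sum)
open import Data.Product using (Σ; ∃; _×_; _,_; proj₁; proj₂)
open import Function.Definitions using (Injective)
open import Relation.Nullary using (Dec; yes; no; ¬_)
open import Relation.Nullary.Decidable using (_×-dec_; _→-dec_; does)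
import Relation.Nullary.Decidable as Dec
open import Relation.Binary.PropositionalEquality using (_≡_; _≢_; refl; sym; trans; cong)

-- Finite simple graphs.  A graph has vertex set  verts ⊆ Fin n  and a
-- symmetric irreflexive Boolean adjacency; only adjacencies between
-- actual vertices count as edges (see  Adj ).

record Graph (n : ℕ) : Set where
  field
    verts      : Subset n
    adj        : Fin n → Fin n → Bool
    adj-sym    : ∀ u v → adj u v ≡ adj v u
    adj-irrefl : ∀ u → adj u u ≡ false
open Graph public

Adj : ∀ {n} → Graph n → Fin n → Fin n → Set
Adj G u v = u ∈ verts G × v ∈ verts G × adj G u v ≡ true

Adj? : ∀ {n} (G : Graph n) u v → Dec (Adj G u v)
Adj? G u v = (u ∈? verts G) ×-dec (v ∈? verts G) ×-dec (adj G u v ≟B true)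

delVertex : ∀ {n} → Graph n → Fin n → Graph n
delVertex G v = record
  { verts = verts G - v ; adj = adj G
  ; adj-sym = adj-sym G ; adj-irrefl = adj-irrefl G }

delVertices2 : ∀ {n} → Graph n → Fin n → Fin n → Graph n
delVertices2 G v w = delVertex (delVertex G v) w

isPair : ∀ {n} → Fin n → Fin n → Fin n → Fin n → Bool
isPair v w a b = (does (a ≟F v) ∧ does (b ≟F w)) ∨ (does (a ≟F w) ∧ does (b ≟F v))

private
  ∧-comm : ∀ x y → x ∧ y ≡ y ∧ x
  ∧-comm false false = refl
  ∧-comm false true  = refl
  ∧-comm true  false = refl
  ∧-comm true  true  = refl

  ∨-comm : ∀ x y → x ∨ y ≡ y ∨ x
  ∨-comm false false = refl
  ∨-comm false true  = refl
  ∨-comm true  false = refl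
  ∨-comm true  true  = refl

  isPair-sym : ∀ {n} (v w a b : Fin n) → isPair v w a b ≡ isPair v w b a
  isPair-sym v w a b
    rewrite ∧-comm (does (a ≟F v)) (does (b ≟F w))
          | ∧-comm (does (a ≟F w)) (does (b ≟F v))
    = ∨-comm (does (b ≟F w) ∧ does (a ≟F v)) (does (b ≟F v) ∧ does (a ≟F w))

  ∧-false : ∀ x y → x ≡ false → x ∧ y ≡ false
  ∧-false .false y refl = refl

delEdge : ∀ {n} → Graph n → Fin n → Fin n → Graph n
delEdge G v w = record
  { verts = verts G
  ; adj = λ a b → adj G a b ∧ not (isPair v w a b)
  ; adj-sym = λ a b → trans (cong (_∧ not (isPair v w a b)) (adj-sym G a b))
                            (cong (λ x → adj G b a ∧ not x) (isPair-sym v w a b))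
  ; adj-irrefl = λ a → ∧-false _ _ (adj-irrefl G a) }

IsCycle : ∀ {n} (G : Graph n) (m : ℕ) → (Fin (suc m) → Fin n) → Set
IsCycle G m c =
  3 ≤ suc m × Injective _≡_ _≡_ c
  × (∀ (i : Fin m) → Adj G (c (inject₁ i)) (c (suc i)))
  × Adj G (c (fromℕ m)) (c zero)

Even : ℕ → Set
Even k = ∃ λ j → k ≡ j + j

NoEvenCycles : ∀ {n} → Graph n → Set
NoEvenCycles {n} G = ∀ m (c : Fin (suc m) → Fin n) → IsCycle G m c → ¬ Even (suc m)

-- A perfect matching of G[S] is
-- encoded by its partner map μ : each s ∈ S is matched to μ s ∈ S with
-- s ~ μ s, and μ (μ s) = s (the matching edges are { s , μ s }, s ∈ S).

IsPerfectMatching : ∀ {n} → Graph n → Subset n → Vec (Fin n) n → Set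
IsPerfectMatching G S μ =
  ∀ s → s ∈ S → lookup μ s ∈ S × Adj G s (lookup μ s) × lookup μ (lookup μ s) ≡ s

PerfectlyMatchable : ∀ {n} → Graph n → Subset n → Set
PerfectlyMatchable G S = S ⊆ verts G × ∃ λ μ → IsPerfectMatching G S μ

private
  ∃Vec? : ∀ {k} (m : ℕ) {P : Vec (Fin k) m → Set} →
          (∀ v → Dec (P v)) → Dec (∃ P)
  ∃Vec? zero    P? = Dec.map′ (λ p → [] , p) (λ { ([] , p) → p }) (P? [])
  ∃Vec? (suc m) {P} P? =
    Dec.map′ (λ { (x , v , p) → x ∷ v , p }) (λ { (x ∷ v , p) → x , v , p })
             (any? λ x → ∃Vec? m (λ v → P? (x ∷ v)))

IsPerfectMatching? : ∀ {n} G S μ → Dec (IsPerfectMatching {n} G S μ)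
IsPerfectMatching? G S μ = all? λ s → (s ∈? S) →-dec
  ((lookup μ s ∈? S) ×-dec Adj? G s (lookup μ s) ×-dec (lookup μ (lookup μ s) ≟F s))

PerfectlyMatchable? : ∀ {n} G S → Dec (PerfectlyMatchable {n} G S)
PerfectlyMatchable? {n} G S = (S ⊆? verts G) ×-dec ∃Vec? n (IsPerfectMatching? G S)

allSubsets : ∀ n → List (Subset n)
allSubsets zero    = [] ∷ []
allSubsets (suc n) = map (true ∷_) (allSubsets n) ++ map (false ∷_) (allSubsets n)

Poly : Set
Poly = ℕ → ℕ

-- p(G;z) : coefficient of z^k is p_{2k}, the number of perfectly
-- matchable sets of size 2k.
pmPoly : ∀ {n} → Graph n → Poly
pmPoly {n} G k = length (filter (λ S → PerfectlyMatchable? G S ×-dec (∣ S ∣ ≟ℕ (2 * k))) (allSubsets n))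

_⊕_ : Poly → Poly → Poly
(p ⊕ q) k = p k + q k

z·_ : Poly → Poly
(z· p) zero    = 0
(z· p) (suc k) = p k

_≈P_ : Poly → Poly → Set
p ≈P q = ∀ k → p k ≡ q k

ΣP[_∣_] : ∀ {n} {P : Fin n → Set} → (∀ w → Dec (P w)) → (Fin n → Poly) → Poly
ΣP[_∣_] {n} P? f k = sum (map (λ w → f w k) (filter P? (allFin n)))

infixl 6 _⊕_
infix 7 z·_
infix 4 _≈P_

-- Without even cycles, a vertex set S has at most one perfect matching: if two perfect
-- matchings μ and μ′ of G[S] disagreed at s, the walk s, μ s, μ′ (μ s), … alternating
-- between them would first revisit a vertex by returning to s after an even number of
-- steps, tracing an even cycle (of length at least 4, since length 2 means μ s = μ′ s).
-- Hence a perfectly matchable S that is no longer matchable in G ∖ vw is matched along vw,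
-- and these sets correspond, via S ↦ S − {v, w}, to the perfectly matchable sets of
-- G − {v, w} with two vertices fewer. Likewise the perfectly matchable sets containing v
-- are partitioned according to the partner of v.

module Submission where

open import Defs
open import Data.Bool using (Bool; true; false; not)
open import Data.Bool.Properties
  using (not-involutive; not-injective; not-¬; ¬-not) renaming (_≟_ to _≟ᵇ_)
open import Data.Empty using (⊥; ⊥-elim)
open import Data.Fin using (Fin; zero; suc; toℕ; inject₁; fromℕ) renaming (_≟_ to _≟ᶠ_)
open import Data.Fin.Properties using (pigeonhole; toℕ-injective; toℕ-inject₁; toℕ-fromℕ; toℕ<n)
open import Data.Fin.Subset using (Subset; inside; outside; _∈_; _∉_; _⊆_; _-_; ∣_∣; ⁅_⁆)
open import Data.Fin.Subset.Properties
  using (_∈?_; drop-there; p─⊥≡p; p─q⊆p; x∈p∧x≢y⇒x∈p-y)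
open import Data.List using (List; []; _∷_; _++_; map; filter; length; allFin)
open import Data.List.Properties using (filter-++; length-++; filter-≐; filter-none; map-cong-local)
open import Data.List.Membership.Propositional using (lose) renaming (_∈_ to _∈ₗ_)
open import Data.List.Membership.Propositional.Properties using (∈-filter⁺; ∈-filter⁻; ∈-allFin)
import Data.List.Relation.Unary.All as All
open import Data.List.Relation.Unary.Any as Any using (Any)
open import Data.List.Relation.Unary.AllPairs using (_∷_)
open import Data.List.Relation.Unary.Unique.Propositional using (Unique)
open import Data.List.Relation.Unary.Unique.Propositional.Properties using (allFin⁺; filter⁺)
open import Data.Nat using (ℕ; zero; suc; _+_; _*_; _<_; _≤_; s≤s; z≤n)
open import Data.Nat.Induction using (<-rec)
open import Data.Nat.ListAction using (sum)
open import Data.Nat.Properties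
  using (+-comm; +-identityʳ; +-suc; *-suc; suc-injective; <-cmp; n<1+n; m≤n⇒m<n∨m≡n)
  renaming (_≟_ to _≟ℕ_)
open import Data.Product using (∃; _×_; _,_; proj₁; proj₂)
import Data.Product as Product
open import Data.Sum using (inj₁; inj₂)
open import Data.Vec using (Vec; _∷_; here; there; lookup; _[_]≔_)
open import Data.Vec.Properties using (lookup∘update; lookup∘update′)
open import Level using (0ℓ)
open import Function using (id; _∘_; case_of_; _⇔_; mk⇔; Equivalence)
open import Relation.Binary using (tri<; tri≈; tri>)
open import Relation.Binary.PropositionalEquality
open import Relation.Nullary using (yes; no; ¬_; contradiction)
open import Relation.Nullary.Decidable using (_×-dec_; ¬?; decidable-stable)
open import Relation.Unary using (Pred; Decidable; _≐_)
open import Relation.Unary.Properties using (_∩?_)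

private
  variable
    A B : Set
    n : ℕ

module _ {P : Pred A 0ℓ} (P? : Decidable P) where

  length-filter-map : (f : B → A) (xs : List B) →
                      length (filter P? (map f xs)) ≡ length (filter (P? ∘ f) xs)
  length-filter-map f []       = refl
  length-filter-map f (x ∷ xs) with P? (f x)
  ... | yes _ = cong suc (length-filter-map f xs)
  ... | no  _ = length-filter-map f xs

  length-filter-×-¬ : {Q : Pred A 0ℓ} (Q? : Decidable Q) (xs : List A) →
    length (filter P? xs) ≡
    length (filter (λ x → P? x ×-dec Q? x) xs) + length (filter (λ x → P? x ×-dec ¬? (Q? x)) xs)
  length-filter-×-¬ Q? []       = refl
  length-filter-×-¬ Q? (x ∷ xs) with P? x | Q? x
  ... | yes _ | yes _ = cong suc (length-filter-×-¬ Q? xs)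
  ... | yes _ | no  _ = trans (cong suc (length-filter-×-¬ Q? xs))
                             (sym (+-suc (length (filter (λ x → P? x ×-dec Q? x) xs)) _))
  ... | no  _ | yes _ = length-filter-×-¬ Q? xs
  ... | no  _ | no  _ = length-filter-×-¬ Q? xs

length-filter-partition :
  {P : Pred A 0ℓ} (P? : Decidable P)
  {Q : B → Pred A 0ℓ} (Q? : ∀ b → Decidable (Q b)) (bs : List B) → Unique bs →
  (∀ {x} → P x → Any (λ b → Q b x) bs) →
  (∀ {b x} → b ∈ₗ bs → Q b x → P x) →
  (∀ {b b′ x} → b ∈ₗ bs → b′ ∈ₗ bs → Q b x → Q b′ x → b ≡ b′) →
  ∀ xs → length (filter P? xs) ≡ sum (map (λ b → length (filter (Q? b) xs)) bs)
length-filter-partition P? Q? [] _ covered _ _ xs =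
  cong length (filter-none P? (All.universal (λ _ px → case covered px of λ ()) xs))
length-filter-partition {P = P} P? {Q} Q? (b ∷ bs) (b∉bs ∷ unique) covered sound disjoint xs =
  trans (length-filter-×-¬ P? (Q? b) xs)
        (cong₂ _+_ (cong length (filter-≐ (λ x → P? x ×-dec Q? b x) (Q? b)
                                           (proj₂ , λ q → sound (Any.here refl) q , q) xs))
                   (length-filter-partition (λ x → P? x ×-dec ¬? (Q? b x)) Q? bs unique
                      covered′ sound′ (λ m m′ → disjoint (Any.there m) (Any.there m′)) xs))
  where
  covered′ : ∀ {x} → P x × ¬ Q b x → Any (λ c → Q c x) bs
  covered′ (px , ¬qb) with covered px
  ... | Any.here qb = contradiction qb ¬qb
  ... | Any.there q = q
  sound′ : ∀ {c x} → c ∈ₗ bs → Q c x → P x × ¬ Q b x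
  sound′ c∈bs qc = sound (Any.there c∈bs) qc
                 , λ qb → All.lookup b∉bs c∈bs (disjoint (Any.here refl) (Any.there c∈bs) qb qc)

x∉p-x : ∀ (p : Subset n) x → x ∉ p - x
x∉p-x (_ ∷ p) zero    ()
x∉p-x (_ ∷ p) (suc x) (there x∈p-x) = x∉p-x p x x∈p-x

module _ {p : Subset n} {x y : Fin n} where

  x∈p-y⇒x∈p : x ∈ p - y → x ∈ p
  x∈p-y⇒x∈p = p─q⊆p p ⁅ y ⁆

  x∈p-y⇒x≢y : x ∈ p - y → x ≢ y
  x∈p-y⇒x≢y x∈p-y refl = x∉p-x p x x∈p-y

∣p∣≡1+∣p-x∣ : {p : Subset n} {x : Fin n} → x ∈ p → ∣ p ∣ ≡ suc ∣ p - x ∣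
∣p∣≡1+∣p-x∣ {p = inside  ∷ p} here          = cong (suc ∘ ∣_∣) (sym (p─⊥≡p p))
∣p∣≡1+∣p-x∣ {p = inside  ∷ p} (there x∈p) = cong suc (∣p∣≡1+∣p-x∣ x∈p)
∣p∣≡1+∣p-x∣ {p = outside ∷ p} (there x∈p) = ∣p∣≡1+∣p-x∣ x∈p

∣p∣≡2+∣p-x-y∣ : {p : Subset n} {x y : Fin n} → x ≢ y → x ∈ p → y ∈ p → ∣ p ∣ ≡ 2 + ∣ p - x - y ∣
∣p∣≡2+∣p-x-y∣ x≢y x∈p y∈p =
  trans (∣p∣≡1+∣p-x∣ x∈p) (cong suc (∣p∣≡1+∣p-x∣ (x∈p∧x≢y⇒x∈p-y y∈p (x≢y ∘ sym))))

ofSize? : (m : ℕ) → Decidable (λ (S : Subset n) → ∣ S ∣ ≡ m)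
ofSize? m S = ∣ S ∣ ≟ℕ m

count : {P : Pred (Subset n) 0ℓ} → Decidable P → ℕ
count {n} P? = length (filter P? (allSubsets n))

module _ {P Q : Pred (Subset n) 0ℓ} (P? : Decidable P) (Q? : Decidable Q) where

  count-cong : P ≐ Q → count P? ≡ count Q?
  count-cong P≐Q = cong length (filter-≐ P? Q? P≐Q (allSubsets n))

  count-×-¬ : count P? ≡ count (λ S → P? S ×-dec Q? S) + count (λ S → P? S ×-dec ¬? (Q? S))
  count-×-¬ = length-filter-×-¬ P? Q? (allSubsets n)

module _ {P : Pred (Subset n) 0ℓ} (P? : Decidable P) where

  count-∅ : (∀ S → ¬ P S) → count P? ≡ 0
  count-∅ ¬P = cong length (filter-none P? (All.universal ¬P (allSubsets n)))

count-∷ : {P : Pred (Subset (suc n)) 0ℓ} (P? : Decidable P) →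
          count P? ≡ count (P? ∘ (inside ∷_)) + count (P? ∘ (outside ∷_))
count-∷ {n} P? = begin
  length (filter P? (map (inside ∷_) L ++ map (outside ∷_) L))
    ≡⟨ cong length (filter-++ P? (map (inside ∷_) L) _) ⟩
  length (filter P? (map (inside ∷_) L) ++ filter P? (map (outside ∷_) L))
    ≡⟨ length-++ (filter P? (map (inside ∷_) L)) ⟩
  length (filter P? (map (inside ∷_) L)) + length (filter P? (map (outside ∷_) L))
    ≡⟨ cong₂ _+_ (length-filter-map P? (inside ∷_) L) (length-filter-map P? (outside ∷_) L) ⟩
  count (P? ∘ (inside ∷_)) + count (P? ∘ (outside ∷_)) ∎
  where
  open ≡-Reasoning
  L = allSubsets n

count-removal : (v : Fin n) {P : Pred (Subset n) 0ℓ} (P? : Decidable P) →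
  count (λ S → v ∈? S ×-dec P? (S - v)) ≡ count (λ S → ¬? (v ∈? S) ×-dec P? S)
count-removal {suc n} zero {P} P? = begin
  count L
    ≡⟨ count-∷ L ⟩
  count (L ∘ (inside ∷_)) + count (L ∘ (outside ∷_))
    ≡⟨ cong₂ _+_ (count-cong (L ∘ (inside ∷_)) (P? ∘ (outside ∷_))
                   ( (λ (_ , p) → subst P (cong (outside ∷_) (p─⊥≡p _)) p)
                   , λ p → here , subst P (cong (outside ∷_) (sym (p─⊥≡p _))) p))
                 (count-∅ (L ∘ (outside ∷_)) λ { _ (() , _) }) ⟩
  count (P? ∘ (outside ∷_)) + 0
    ≡⟨ +-identityʳ _ ⟩
  count (P? ∘ (outside ∷_))
    ≡⟨ cong₂ _+_ (count-∅ (R ∘ (inside ∷_)) λ _ (z∉ , _) → z∉ here)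
                 (count-cong (R ∘ (outside ∷_)) (P? ∘ (outside ∷_)) (proj₂ , λ p → (λ ()) , p)) ⟨
  count (R ∘ (inside ∷_)) + count (R ∘ (outside ∷_))
    ≡⟨ count-∷ R ⟨
  count R ∎
  where
  open ≡-Reasoning
  L = λ S → zero ∈? S ×-dec P? (S - zero)
  R = λ S → ¬? (zero ∈? S) ×-dec P? S
count-removal {suc n} (suc v) P? = begin
  count L
    ≡⟨ count-∷ L ⟩
  count (L ∘ (inside ∷_)) + count (L ∘ (outside ∷_))
    ≡⟨ cong₂ _+_ (removal-below inside) (removal-below outside) ⟩
  count (R ∘ (inside ∷_)) + count (R ∘ (outside ∷_))
    ≡⟨ count-∷ R ⟨
  count R ∎
  where
  open ≡-Reasoning
  L = λ S → suc v ∈? S ×-dec P? (S - suc v)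
  R = λ S → ¬? (suc v ∈? S) ×-dec P? S
  removal-below : ∀ b → count (L ∘ (b ∷_)) ≡ count (R ∘ (b ∷_))
  removal-below b = begin
    count (L ∘ (b ∷_))
      ≡⟨ count-cong (L ∘ (b ∷_)) (λ T → v ∈? T ×-dec P? (b ∷ (T - v)))
                    (Product.map₁ drop-there , Product.map₁ there) ⟩
    count (λ T → v ∈? T ×-dec P? (b ∷ (T - v)))
      ≡⟨ count-removal v (P? ∘ (b ∷_)) ⟩
    count (λ T → ¬? (v ∈? T) ×-dec P? (b ∷ T))
      ≡⟨ count-cong (λ T → ¬? (v ∈? T) ×-dec P? (b ∷ T)) (R ∘ (b ∷_))
                    (Product.map₁ (_∘ drop-there) , Product.map₁ (_∘ there)) ⟩
    count (R ∘ (b ∷_)) ∎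

count-removal₂ : {v w : Fin n} → v ≢ w → {P : Pred (Subset n) 0ℓ} (P? : Decidable P) →
  (∀ {T} → P T → v ∉ T × w ∉ T) →
  count (λ S → v ∈? S ×-dec w ∈? S ×-dec P? (S - v - w)) ≡ count P?
count-removal₂ {v = v} {w} v≢w {P} P? avoids = begin
  count (λ S → v ∈? S ×-dec w ∈? S ×-dec P? (S - v - w))
    ≡⟨ count-cong (λ S → v ∈? S ×-dec w ∈? S ×-dec P? (S - v - w)) L′
         ( Product.map₂ (Product.map₁ λ w∈S → x∈p∧x≢y⇒x∈p-y w∈S (v≢w ∘ sym))
         , Product.map₂ (Product.map₁ x∈p-y⇒x∈p)) ⟩
  count L′
    ≡⟨ count-removal v (λ U → w ∈? U ×-dec P? (U - w)) ⟩
  count (λ U → ¬? (v ∈? U) ×-dec w ∈? U ×-dec P? (U - w))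
    ≡⟨ count-cong (λ U → ¬? (v ∈? U) ×-dec w ∈? U ×-dec P? (U - w)) R′
         ( (λ (v∉U , w∈U , p) → w∈U , v∉U ∘ x∈p-y⇒x∈p , p)
         , (λ (w∈U , v∉U-w , p) → (λ v∈U → v∉U-w (x∈p∧x≢y⇒x∈p-y v∈U v≢w)) , w∈U , p)) ⟩
  count R′
    ≡⟨ count-removal w (λ T → ¬? (v ∈? T) ×-dec P? T) ⟩
  count (λ T → ¬? (w ∈? T) ×-dec ¬? (v ∈? T) ×-dec P? T)
    ≡⟨ count-cong (λ T → ¬? (w ∈? T) ×-dec ¬? (v ∈? T) ×-dec P? T) P?
         (proj₂ ∘ proj₂ , λ p → proj₂ (avoids p) , proj₁ (avoids p) , p) ⟩
  count P? ∎
  where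
  open ≡-Reasoning
  L′ = λ S → v ∈? S ×-dec w ∈? S - v ×-dec P? (S - v - w)
  R′ = λ U → w ∈? U ×-dec ¬? (v ∈? U - w) ×-dec P? (U - w)

sum-z· : (ws : List A) (p : A → Poly) → ∀ k →
         sum (map (λ w → (z· p w) k) ws) ≡ (z· λ j → sum (map (λ w → p w j) ws)) k
sum-z· ws       p (suc k) = refl
sum-z· []       p zero    = refl
sum-z· (w ∷ ws) p zero    = sum-z· ws p zero

module _ {G : Graph n} where

  Adj-sym : ∀ {a b} → Adj G a b → Adj G b a
  Adj-sym {a} {b} (a∈G , b∈G , a~b) = b∈G , a∈G , trans (adj-sym G b a) a~b

  Adj-irrefl : ∀ {a} → ¬ Adj G a a
  Adj-irrefl {a} (_ , _ , a~a) = case trans (sym a~a) (adj-irrefl G a) of λ ()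

  Adj⇒≢ : ∀ {a b} → Adj G a b → a ≢ b
  Adj⇒≢ a~a refl = Adj-irrefl a~a

infix 4 _⊑_
record _⊑_ (H G : Graph n) : Set where
  constructor _,_
  field
    verts-⊆ : verts H ⊆ verts G
    Adj-⊆   : ∀ {a b} → Adj H a b → Adj G a b

⊑-trans : {F G H : Graph n} → F ⊑ G → G ⊑ H → F ⊑ H
⊑-trans (V₁ , E₁) (V₂ , E₂) = (λ x∈F → V₂ (V₁ x∈F)) , (λ a~b → E₂ (E₁ a~b))

module _ {G : Graph n} {v : Fin n} where

  delVertex-⊑ : delVertex G v ⊑ G
  delVertex-⊑ = x∈p-y⇒x∈p , λ (a∈ , b∈ , a~b) → x∈p-y⇒x∈p a∈ , x∈p-y⇒x∈p b∈ , a~b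

  Adj-delVertex : ∀ {a b} → Adj G a b → a ≢ v → b ≢ v → Adj (delVertex G v) a b
  Adj-delVertex (a∈ , b∈ , a~b) a≢v b≢v = x∈p∧x≢y⇒x∈p-y a∈ a≢v , x∈p∧x≢y⇒x∈p-y b∈ b≢v , a~b

isPair-diag : (v w : Fin n) → isPair v w v w ≡ true
isPair-diag v w with v ≟ᶠ v | w ≟ᶠ w
... | yes _   | yes _   = refl
... | no v≢v  | _       = contradiction refl v≢v
... | yes _   | no w≢w  = contradiction refl w≢w

isPair-false : {v w a b : Fin n} → ¬ (a ≡ v × b ≡ w) → ¬ (a ≡ w × b ≡ v) → isPair v w a b ≡ false
isPair-false {v = v} {w} {a} {b} ¬vw ¬wv with a ≟ᶠ v | b ≟ᶠ w | a ≟ᶠ w | b ≟ᶠ v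
... | yes a≡v | yes b≡w | _       | _       = contradiction (a≡v , b≡w) ¬vw
... | _       | _       | yes a≡w | yes b≡v = contradiction (a≡w , b≡v) ¬wv
... | no _    | _       | no _    | _       = refl
... | no _    | _       | yes _   | no _    = refl
... | yes _   | no _    | no _    | _       = refl
... | yes _   | no _    | yes _   | no _    = refl

module _ {G : Graph n} {v w : Fin n} where

  Adj-delEdge⁻ : ∀ {a b} → Adj (delEdge G v w) a b → Adj G a b × isPair v w a b ≡ false
  Adj-delEdge⁻ {a} {b} (a∈ , b∈ , e) with adj G a b | isPair v w a b
  Adj-delEdge⁻ (a∈ , b∈ , e) | true  | false = (a∈ , b∈ , refl) , refl
  Adj-delEdge⁻ (a∈ , b∈ , ()) | true  | true
  Adj-delEdge⁻ (a∈ , b∈ , ()) | false | _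

  Adj-delEdge⁺ : ∀ {a b} → Adj G a b → isPair v w a b ≡ false → Adj (delEdge G v w) a b
  Adj-delEdge⁺ (a∈ , b∈ , a~b) not-vw rewrite a~b | not-vw = a∈ , b∈ , refl

  delEdge-⊑ : delEdge G v w ⊑ G
  delEdge-⊑ = id , proj₁ ∘ Adj-delEdge⁻

  ¬Adj-delEdge : ¬ Adj (delEdge G v w) v w
  ¬Adj-delEdge v~w = case trans (sym (isPair-diag v w)) (proj₂ (Adj-delEdge⁻ v~w)) of λ ()

module _ {G : Graph n} {S : Subset n} {μ : Vec (Fin n) n} (pm : IsPerfectMatching G S μ) where

  matching-flip : ∀ {a b} → a ∈ S → lookup μ a ≡ b → lookup μ b ≡ a
  matching-flip {a} a∈S refl = proj₂ (proj₂ (pm a a∈S))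

  IsPerfectMatching-⊑ : {H : Graph n} → G ⊑ H → IsPerfectMatching H S μ
  IsPerfectMatching-⊑ (_ , E) s s∈S = Product.map₂ (Product.map₁ E) (pm s s∈S)

PerfectlyMatchable-⊑ : {G H : Graph n} {S : Subset n} → G ⊑ H →
                       PerfectlyMatchable G S → PerfectlyMatchable H S
PerfectlyMatchable-⊑ {G = G} {S = S} G⊑H@(V , _) (S⊆G , μ , pm) =
  (λ s∈S → V (S⊆G s∈S)) , μ , IsPerfectMatching-⊑ {G = G} {S = S} {μ = μ} pm G⊑H

PerfectlyMatchable-delVertex : {G : Graph n} {S : Subset n} {v : Fin n} → v ∉ S →
                               PerfectlyMatchable G S → PerfectlyMatchable (delVertex G v) S
PerfectlyMatchable-delVertex {G = G} {v = v} v∉S (S⊆G , μ , pm) =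
  (λ s∈S → x∈p∧x≢y⇒x∈p-y (S⊆G s∈S) (avoids s∈S)) , μ ,
  λ s s∈S → let (μs∈S , s~μs , μμs≡s) = pm s s∈S in
            μs∈S , Adj-delVertex {G = G} s~μs (avoids s∈S) (avoids μs∈S) , μμs≡s
  where
  avoids : ∀ {s} → s ∈ _ → s ≢ v
  avoids s∈S refl = v∉S s∈S

PerfectlyMatchable-delEdge : {G : Graph n} {S : Subset n} {μ : Vec (Fin n) n} {v w : Fin n} →
  S ⊆ verts G → IsPerfectMatching G S μ → ¬ (v ∈ S × lookup μ v ≡ w) →
  PerfectlyMatchable (delEdge G v w) S
PerfectlyMatchable-delEdge {G = G} {S} {μ} {v} {w} S⊆G pm vw∉μ =
  S⊆G , μ , λ s s∈S → let (μs∈S , s~μs , μμs≡s) = pm s s∈S in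
    μs∈S , Adj-delEdge⁺ {G = G} s~μs (isPair-false (uses-vw s∈S) (uses-wv s∈S)) , μμs≡s
  where
  uses-vw : ∀ {s} → s ∈ S → ¬ (s ≡ v × lookup μ s ≡ w)
  uses-vw s∈S (refl , μv≡w) = vw∉μ (s∈S , μv≡w)
  uses-wv : ∀ {s} → s ∈ S → ¬ (s ≡ w × lookup μ s ≡ v)
  uses-wv s∈S (refl , μw≡v) =
    vw∉μ (subst (_∈ S) μw≡v (proj₁ (pm _ s∈S)) , matching-flip {G = G} {μ = μ} pm s∈S μw≡v)

-- For adjacent v and w: S has a perfect matching in G pairing v with w.
MatchedVia : Graph n → Fin n → Fin n → Subset n → Set
MatchedVia G v w S = v ∈ S × w ∈ S × PerfectlyMatchable (delVertices2 G v w) (S - v - w)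

MatchedVia? : (G : Graph n) (v w : Fin n) → Decidable (MatchedVia G v w)
MatchedVia? G v w S = v ∈? S ×-dec w ∈? S ×-dec PerfectlyMatchable? (delVertices2 G v w) (S - v - w)

module _ {G : Graph n} {v w : Fin n} {S : Subset n} where

  private
    D = delVertices2 G v w

    ∈-D⁺ : ∀ {T : Subset n} {x} → x ∈ T → x ≢ v → x ≢ w → x ∈ T - v - w
    ∈-D⁺ x∈T x≢v x≢w = x∈p∧x≢y⇒x∈p-y (x∈p∧x≢y⇒x∈p-y x∈T x≢v) x≢w

    ∈-D⁻ : ∀ {T : Subset n} {x} → x ∈ T - v - w → x ∈ T × x ≢ v × x ≢ w
    ∈-D⁻ x∈T-v-w = x∈p-y⇒x∈p (x∈p-y⇒x∈p x∈T-v-w) , x∈p-y⇒x≢y (x∈p-y⇒x∈p x∈T-v-w) , x∈p-y⇒x≢y x∈T-v-w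

    D-⊑ : D ⊑ G
    D-⊑ = ⊑-trans delVertex-⊑ delVertex-⊑

    Adj-D : ∀ {a b} → Adj G a b → a ≢ v → a ≢ w → b ≢ v → b ≢ w → Adj D a b
    Adj-D a~b a≢v a≢w b≢v b≢w =
      Adj-delVertex {G = delVertex G v} (Adj-delVertex {G = G} a~b a≢v b≢v) a≢w b≢w

  MatchedVia-fromMatching : {μ : Vec (Fin n) n} → S ⊆ verts G → IsPerfectMatching G S μ →
                            v ∈ S → lookup μ v ≡ w → MatchedVia G v w S
  MatchedVia-fromMatching {μ} S⊆G pm v∈S μv≡w = v∈S , w∈S , S-v-w⊆D , μ , pm′
    where
    flip = matching-flip {G = G} {μ = μ} pm
    w∈S : w ∈ S
    w∈S = subst (_∈ S) μv≡w (proj₁ (pm v v∈S))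
    μw≡v : lookup μ w ≡ v
    μw≡v = flip v∈S μv≡w
    S-v-w⊆D : S - v - w ⊆ verts D
    S-v-w⊆D s∈ = let (s∈S , s≢v , s≢w) = ∈-D⁻ s∈ in ∈-D⁺ (S⊆G s∈S) s≢v s≢w
    partner-avoids : ∀ {s} → s ∈ S → s ≢ v → s ≢ w → lookup μ s ≢ v × lookup μ s ≢ w
    partner-avoids s∈S s≢v s≢w = (λ μs≡v → s≢w (trans (sym (flip s∈S μs≡v)) μv≡w))
                               , (λ μs≡w → s≢v (trans (sym (flip s∈S μs≡w)) μw≡v))
    pm′ : IsPerfectMatching D (S - v - w) μ
    pm′ s s∈ =
      let (s∈S , s≢v , s≢w)     = ∈-D⁻ s∈
          (μs∈S , s~μs , μμs≡s) = pm s s∈S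
          (μs≢v , μs≢w)         = partner-avoids s∈S s≢v s≢w
      in ∈-D⁺ μs∈S μs≢v μs≢w , Adj-D s~μs s≢v s≢w μs≢v μs≢w , μμs≡s

  MatchedVia-toMatching : Adj G v w → MatchedVia G v w S →
                          S ⊆ verts G × ∃ λ μ → IsPerfectMatching G S μ × lookup μ v ≡ w
  MatchedVia-toMatching v~w (v∈S , w∈S , S-v-w⊆D , ν , pm) = S⊆G , μ , pmμ , μv≡w
    where
    v≢w = Adj⇒≢ {G = G} v~w
    μ = ν [ v ]≔ w [ w ]≔ v
    μv≡w : lookup μ v ≡ w
    μv≡w = trans (lookup∘update′ v≢w (ν [ v ]≔ w) v) (lookup∘update v ν w)
    μw≡v : lookup μ w ≡ v
    μw≡v = lookup∘update w (ν [ v ]≔ w) v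
    μ≡ν : ∀ {x} → x ≢ v → x ≢ w → lookup μ x ≡ lookup ν x
    μ≡ν x≢v x≢w = trans (lookup∘update′ x≢w (ν [ v ]≔ w) v) (lookup∘update′ x≢v ν w)
    S⊆G : S ⊆ verts G
    S⊆G {x} x∈S with x ≟ᶠ v | x ≟ᶠ w
    ... | yes refl | _        = proj₁ v~w
    ... | no _     | yes refl = proj₁ (proj₂ v~w)
    ... | no x≢v   | no x≢w   = _⊑_.verts-⊆ D-⊑ (S-v-w⊆D (∈-D⁺ x∈S x≢v x≢w))
    pmμ : IsPerfectMatching G S μ
    pmμ s s∈S with s ≟ᶠ v | s ≟ᶠ w
    ... | yes refl | _        rewrite μv≡w = w∈S , v~w , μw≡v
    ... | no _     | yes refl rewrite μw≡v = v∈S , Adj-sym {G = G} v~w , μv≡w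
    ... | no s≢v   | no s≢w   rewrite μ≡ν s≢v s≢w =
      let (νs∈ , s~νs , ννs≡s) = pm s (∈-D⁺ s∈S s≢v s≢w)
          (νs∈S , νs≢v , νs≢w) = ∈-D⁻ νs∈
      in νs∈S , _⊑_.Adj-⊆ D-⊑ s~νs , trans (μ≡ν νs≢v νs≢w) ννs≡s

count-MatchedVia : (G : Graph n) {v w : Fin n} → v ≢ w → ∀ k →
  count (MatchedVia? G v w ∩? ofSize? (2 * k)) ≡ (z· pmPoly (delVertices2 G v w)) k
count-MatchedVia G {v} {w} v≢w zero =
  count-∅ (MatchedVia? G v w ∩? ofSize? 0) λ _ ((v∈S , w∈S , _) , ∣S∣≡0) →
    case trans (sym ∣S∣≡0) (∣p∣≡2+∣p-x-y∣ v≢w v∈S w∈S) of λ ()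
count-MatchedVia G {v} {w} v≢w (suc k) = begin
  count (MatchedVia? G v w ∩? ofSize? (2 * suc k))
    ≡⟨ count-cong (MatchedVia? G v w ∩? ofSize? (2 * suc k)) L
         ( (λ ((v∈S , w∈S , pm) , size) →
               v∈S , w∈S , pm , suc-injective (suc-injective
                 (trans (sym (∣p∣≡2+∣p-x-y∣ v≢w v∈S w∈S)) (trans size (*-suc 2 k)))))
         , (λ (v∈S , w∈S , pm , size) →
               (v∈S , w∈S , pm) , trans (∣p∣≡2+∣p-x-y∣ v≢w v∈S w∈S)
                                        (trans (cong (2 +_) size) (sym (*-suc 2 k))))) ⟩
  count L
    ≡⟨ count-removal₂ v≢w R avoids ⟩
  count R ∎
  where
  open ≡-Reasoning
  D = delVertices2 G v w
  R = PerfectlyMatchable? D ∩? ofSize? (2 * k)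
  L = λ S → v ∈? S ×-dec w ∈? S ×-dec R (S - v - w)
  avoids : ∀ {T} → PerfectlyMatchable D T × ∣ T ∣ ≡ 2 * k → v ∉ T × w ∉ T
  avoids ((T⊆D , _) , _) = (λ v∈T → x∈p-y⇒x≢y (x∈p-y⇒x∈p (T⊆D v∈T)) refl)
                         , (λ w∈T → x∈p-y⇒x≢y (T⊆D w∈T) refl)

isEven : ℕ → Bool
isEven zero    = true
isEven (suc k) = not (isEven k)

isEven⇒Even : ∀ k → isEven k ≡ true → Even k
isEven⇒Even zero          _ = 0 , refl
isEven⇒Even (suc (suc k)) e with isEven⇒Even k (trans (sym (not-involutive (isEven k))) e)
... | j , refl = suc j , cong suc (sym (+-suc j j))

module AlternatingWalk {G : Graph n} {S : Subset n} {μ μ′ : Vec (Fin n) n}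
  (pm : IsPerfectMatching G S μ) (pm′ : IsPerfectMatching G S μ′) (s : Fin n) (s∈S : s ∈ S) where

  matching : Bool → Vec (Fin n) n
  matching true  = μ
  matching false = μ′

  matching-perfect : ∀ b → IsPerfectMatching G S (matching b)
  matching-perfect true  = pm
  matching-perfect false = pm′

  partner : Bool → Fin n → Fin n
  partner p = lookup (matching p)

  walk : ℕ → Fin n
  walk zero    = s
  walk (suc k) = partner (isEven k) (walk k)

  walk∈S : ∀ k → walk k ∈ S
  walk∈S zero    = s∈S
  walk∈S (suc k) = proj₁ (matching-perfect (isEven k) (walk k) (walk∈S k))

  walk-adj : ∀ k → Adj G (walk k) (walk (suc k))
  walk-adj k = proj₁ (proj₂ (matching-perfect (isEven k) (walk k) (walk∈S k)))

  walk-back : ∀ k → partner (isEven k) (walk (suc k)) ≡ walk k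
  walk-back k = proj₂ (proj₂ (matching-perfect (isEven k) (walk k) (walk∈S k)))

  walk-retreat : ∀ a b → isEven a ≡ isEven b → walk (suc a) ≡ walk (suc b) → walk a ≡ walk b
  walk-retreat a b same eq = trans (sym (walk-back a)) (trans (cong₂ partner same eq) (walk-back b))

  walk-fold : ∀ a b → isEven a ≡ isEven b → walk a ≡ walk (suc b) → walk (suc a) ≡ walk b
  walk-fold a b same eq = trans (cong₂ partner same eq) (walk-back b)

  Repeats : ℕ → Set
  Repeats b = ∃ λ a → a < b × walk a ≡ walk b

  walk-repeats : ∃ Repeats
  walk-repeats =
    let (i , j , i<j , eq) = pigeonhole (n<1+n n) (walk ∘ toℕ) in toℕ j , toℕ i , i<j , eq

  -- Folding an odd stretch of the walk inwards from both ends runs into a loop or into an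
  -- earlier repetition.
  oddGap : ∀ {a b} → (∀ {c} → c < suc b → ¬ Repeats c) → a ≤ b → isEven a ≡ isEven b →
           walk a ≢ walk (suc b)
  oddGap {a} {b} first a≤b same eq with m≤n⇒m<n∨m≡n a≤b
  ... | inj₂ refl = Adj-irrefl {G = G} (subst (Adj G (walk a)) (walk-fold a a same eq) (walk-adj a))
  ... | inj₁ a<b with m≤n⇒m<n∨m≡n a<b
  ...   | inj₁ 1+a<b = first (n<1+n b) (suc a , 1+a<b , walk-fold a b same eq)
  ...   | inj₂ refl  = not-¬ refl same

  firstRepeat : ∀ {a b} → (∀ {c} → c < b → ¬ Repeats c) → a < b → walk a ≡ walk b →
                a ≡ 0 × isEven b ≡ true
  firstRepeat {a} {suc b} first (s≤s a≤b) eq with isEven a ≟ᵇ isEven (suc b)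
  firstRepeat {zero}  {suc b} first _         eq | yes same = refl , sym same
  firstRepeat {suc a} {suc b} first (s≤s a<b) eq | yes same =
    ⊥-elim (first (n<1+n b) (a , a<b , walk-retreat a b (not-injective same) eq))
  firstRepeat {a}     {suc b} first (s≤s a≤b) eq | no differ =
    ⊥-elim (oddGap first a≤b (trans (¬-not differ) (not-involutive (isEven b))) eq)

  walk-isCycle : ∀ {m} → (∀ {c} → c < suc m → ¬ Repeats c) → walk (suc m) ≡ s → 2 ≤ m →
                 IsCycle G m (walk ∘ toℕ)
  walk-isCycle {m} first closed 2≤m = s≤s 2≤m , injective , consecutive , closing
    where
    injective : ∀ {i j} → walk (toℕ i) ≡ walk (toℕ j) → i ≡ j
    injective {i} {j} eq with <-cmp (toℕ i) (toℕ j)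
    ... | tri< i<j _ _ = contradiction (toℕ i , i<j , eq) (first (toℕ<n j))
    ... | tri≈ _ i≡j _ = toℕ-injective i≡j
    ... | tri> _ _ j<i = contradiction (toℕ j , j<i , sym eq) (first (toℕ<n i))
    consecutive : ∀ i → Adj G (walk (toℕ (inject₁ i))) (walk (suc (toℕ i)))
    consecutive i rewrite toℕ-inject₁ i = walk-adj (toℕ i)
    closing : Adj G (walk (toℕ (fromℕ m))) s
    closing rewrite toℕ-fromℕ m = subst (Adj G (walk m)) closed (walk-adj m)

  noRepeats : NoEvenCycles G → lookup μ s ≢ lookup μ′ s → ∀ b → ¬ Repeats b
  noRepeats noEven μs≢μ′s = <-rec (λ b → ¬ Repeats b) λ b first (a , a<b , eq) →
    let (a≡0 , even) = firstRepeat first a<b eq in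
    closedWalk b first (subst (_< b) a≡0 a<b) (subst (λ a → walk a ≡ walk b) a≡0 eq) even
    where
    closedWalk : ∀ b → (∀ {c} → c < b → ¬ Repeats c) → 0 < b → s ≡ walk b → isEven b ≡ true → ⊥
    closedWalk 1 _ _ _ ()
    closedWalk 2 _ _ closed _ =
      μs≢μ′s (sym (trans (cong (lookup μ′) closed) (proj₂ (proj₂ (pm′ (lookup μ s) (walk∈S 1))))))
    closedWalk (suc m@(suc (suc _))) first _ closed even =
      noEven m (walk ∘ toℕ) (walk-isCycle first (sym closed) (s≤s (s≤s z≤n)))
             (isEven⇒Even (suc m) even)

perfectMatching-unique : {G : Graph n} → NoEvenCycles G → {S : Subset n} {μ μ′ : Vec (Fin n) n} →
  IsPerfectMatching G S μ → IsPerfectMatching G S μ′ → ∀ {s} → s ∈ S → lookup μ s ≡ lookup μ′ s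
perfectMatching-unique {G = G} noEven {S} {μ} {μ′} pm pm′ {s} s∈S =
  decidable-stable (lookup μ s ≟ᶠ lookup μ′ s) λ μs≢μ′s →
    noRepeats noEven μs≢μ′s (proj₁ walk-repeats) (proj₂ walk-repeats)
  where open AlternatingWalk {G = G} {S} {μ} {μ′} pm pm′ s s∈S

module _ {G : Graph n} (noEven : NoEvenCycles G) {v w : Fin n} (v~w : Adj G v w)
         {S : Subset n} where

  needsEdge⇔MatchedVia :
    (PerfectlyMatchable G S × ¬ PerfectlyMatchable (delEdge G v w) S) ⇔ MatchedVia G v w S
  needsEdge⇔MatchedVia = mk⇔ to from
    where
    to : PerfectlyMatchable G S × ¬ PerfectlyMatchable (delEdge G v w) S → MatchedVia G v w S
    to ((S⊆G , μ , pm) , ¬pmG∖vw) with v ∈? S ×-dec lookup μ v ≟ᶠ w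
    ... | yes (v∈S , μv≡w) = MatchedVia-fromMatching {G = G} {μ = μ} S⊆G pm v∈S μv≡w
    ... | no  vw∉μ         =
      contradiction (PerfectlyMatchable-delEdge {G = G} {μ = μ} S⊆G pm vw∉μ) ¬pmG∖vw
    from : MatchedVia G v w S → PerfectlyMatchable G S × ¬ PerfectlyMatchable (delEdge G v w) S
    from m@(v∈S , _) with MatchedVia-toMatching {G = G} v~w m
    ... | S⊆G , μ , pm , μv≡w = (S⊆G , μ , pm) , λ (_ , ν , pmν) →
      let pmν-G = IsPerfectMatching-⊑ {G = delEdge G v w} {μ = ν} pmν delEdge-⊑
          νv≡w  = trans (sym (perfectMatching-unique {G = G} noEven {μ = μ} {ν} pm pmν-G v∈S)) μv≡w
      in ¬Adj-delEdge {G = G} (subst (Adj (delEdge G v w) v) νv≡w (proj₁ (proj₂ (pmν v v∈S))))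

PerfectlyMatchableOfSize? : (G : Graph n) (m : ℕ) →
                            Decidable (λ S → PerfectlyMatchable G S × ∣ S ∣ ≡ m)
PerfectlyMatchableOfSize? G m = PerfectlyMatchable? G ∩? ofSize? m

module _ {G : Graph n} (m : ℕ) where

  count-matchable-⊑ : {H : Graph n} → H ⊑ G →
    count (λ S → PerfectlyMatchableOfSize? G m S ×-dec PerfectlyMatchable? H S)
      ≡ count (PerfectlyMatchableOfSize? H m)
  count-matchable-⊑ {H} H⊑G =
    count-cong (λ S → PerfectlyMatchableOfSize? G m S ×-dec PerfectlyMatchable? H S)
               (PerfectlyMatchableOfSize? H m)
               ( (λ ((_ , size) , pmH) → pmH , size)
               , (λ {S} (pmH , size) → (PerfectlyMatchable-⊑ {G = H} {S = S} H⊑G pmH , size) , pmH))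

  count-avoiding : (v : Fin n) →
    count (λ S → PerfectlyMatchableOfSize? G m S ×-dec ¬? (v ∈? S))
      ≡ count (PerfectlyMatchableOfSize? (delVertex G v) m)
  count-avoiding v =
    count-cong (λ S → PerfectlyMatchableOfSize? G m S ×-dec ¬? (v ∈? S))
               (PerfectlyMatchableOfSize? (delVertex G v) m)
               ( (λ ((pm , size) , v∉S) → PerfectlyMatchable-delVertex {G = G} v∉S pm , size)
               , (λ {S} (pm-v , size) →
                     (PerfectlyMatchable-⊑ {G = delVertex G v} {S = S} delVertex-⊑ pm-v , size)
                   , λ v∈S → x∈p-y⇒x≢y (proj₁ pm-v v∈S) refl))

count-needingEdge : {G : Graph n} → NoEvenCycles G → {v w : Fin n} → Adj G v w → ∀ k →
  count (λ S → PerfectlyMatchableOfSize? G (2 * k) S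
                 ×-dec ¬? (PerfectlyMatchable? (delEdge G v w) S))
    ≡ (z· pmPoly (delVertices2 G v w)) k
count-needingEdge {G = G} noEven {v} {w} v~w k =
  trans (count-cong
           (λ S → PerfectlyMatchableOfSize? G (2 * k) S
                    ×-dec ¬? (PerfectlyMatchable? (delEdge G v w) S))
           (MatchedVia? G v w ∩? ofSize? (2 * k))
           ( (λ {S} ((pm , size) , ¬pm∖vw) → Equivalence.to (split {S}) (pm , ¬pm∖vw) , size)
           , (λ {S} (m , size) → let (pm , ¬pm∖vw) = Equivalence.from (split {S}) m in
                                 (pm , size) , ¬pm∖vw)))
        (count-MatchedVia G (Adj⇒≢ {G = G} v~w) k)
  where
  split : ∀ {S} →
    (PerfectlyMatchable G S × ¬ PerfectlyMatchable (delEdge G v w) S) ⇔ MatchedVia G v w S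
  split = needsEdge⇔MatchedVia {G = G} noEven v~w

module _ {n} {G : Graph n} (noEven : NoEvenCycles G) (v : Fin n) (k : ℕ) where

  private
    ws = filter (Adj? G v) (allFin n)
    P  = PerfectlyMatchableOfSize? G (2 * k)
    Q  = λ w → MatchedVia? G v w ∩? ofSize? (2 * k)

    neighbour : ∀ {w} → w ∈ₗ ws → Adj G v w
    neighbour = proj₂ ∘ ∈-filter⁻ (Adj? G v) {xs = allFin n}

  count-containing≡sum-MatchedVia :
    count (λ S → P S ×-dec v ∈? S) ≡ sum (map (λ w → count (Q w)) ws)
  count-containing≡sum-MatchedVia =
    length-filter-partition (λ S → P S ×-dec v ∈? S) Q ws (filter⁺ (Adj? G v) (allFin⁺ n))
      covered sound disjoint (allSubsets n)
    where
    covered : ∀ {S} → (PerfectlyMatchable G S × ∣ S ∣ ≡ 2 * k) × v ∈ S →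
              Any (λ w → MatchedVia G v w S × ∣ S ∣ ≡ 2 * k) ws
    covered (((S⊆G , μ , pm) , size) , v∈S) =
      lose (∈-filter⁺ (Adj? G v) (∈-allFin _) (proj₁ (proj₂ (pm v v∈S))))
           (MatchedVia-fromMatching {G = G} {μ = μ} S⊆G pm v∈S refl , size)
    sound : ∀ {w S} → w ∈ₗ ws → MatchedVia G v w S × ∣ S ∣ ≡ 2 * k →
            (PerfectlyMatchable G S × ∣ S ∣ ≡ 2 * k) × v ∈ S
    sound w∈ws (m@(v∈S , _) , size) =
      let (S⊆G , μ , pm , _) = MatchedVia-toMatching {G = G} (neighbour w∈ws) m
      in ((S⊆G , μ , pm) , size) , v∈S
    disjoint : ∀ {w w′ S} → w ∈ₗ ws → w′ ∈ₗ ws →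
               MatchedVia G v w S × ∣ S ∣ ≡ 2 * k → MatchedVia G v w′ S × ∣ S ∣ ≡ 2 * k → w ≡ w′
    disjoint w∈ws w′∈ws (m@(v∈S , _) , _) (m′ , _) =
      let (_ , μ  , pm  , μv≡w)   = MatchedVia-toMatching {G = G} (neighbour w∈ws) m
          (_ , μ′ , pm′ , μ′v≡w′) = MatchedVia-toMatching {G = G} (neighbour w′∈ws) m′
          μv≡μ′v                  = perfectMatching-unique {G = G} noEven {μ = μ} {μ′} pm pm′ v∈S
      in trans (sym μv≡w) (trans μv≡μ′v μ′v≡w′)

  count-containing :
    count (λ S → P S ×-dec v ∈? S) ≡ (z· ΣP[ Adj? G v ∣ (λ w → pmPoly (delVertices2 G v w)) ]) k
  count-containing = begin
    count (λ S → P S ×-dec v ∈? S)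
      ≡⟨ count-containing≡sum-MatchedVia ⟩
    sum (map (λ w → count (Q w)) ws)
      ≡⟨ cong sum (map-cong-local (All.tabulate λ w∈ws →
           count-MatchedVia G (Adj⇒≢ {G = G} (neighbour w∈ws)) k)) ⟩
    sum (map (λ w → (z· pmPoly (delVertices2 G v w)) k) ws)
      ≡⟨ sum-z· ws (λ w → pmPoly (delVertices2 G v w)) k ⟩
    (z· ΣP[ Adj? G v ∣ (λ w → pmPoly (delVertices2 G v w)) ]) k ∎
    where open ≡-Reasoning

pmPoly-delEdge : (G : Graph n) → NoEvenCycles G → (v w : Fin n) → Adj G v w →
                 pmPoly G ≈P pmPoly (delEdge G v w) ⊕ z· pmPoly (delVertices2 G v w)
pmPoly-delEdge G noEven v w v~w k =
  trans (count-×-¬ (PerfectlyMatchableOfSize? G (2 * k)) (PerfectlyMatchable? (delEdge G v w)))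
        (cong₂ _+_ (count-matchable-⊑ {G = G} (2 * k) delEdge-⊑)
                   (count-needingEdge {G = G} noEven v~w k))

pmPoly-delVertex : (G : Graph n) → NoEvenCycles G → (v : Fin n) →
  pmPoly G ≈P pmPoly (delVertex G v) ⊕ z· ΣP[ Adj? G v ∣ (λ w → pmPoly (delVertices2 G v w)) ]
pmPoly-delVertex G noEven v k =
  trans (count-×-¬ P (v ∈?_))
        (trans (+-comm (count (λ S → P S ×-dec v ∈? S)) _)
               (cong₂ _+_ (count-avoiding {G = G} (2 * k) v) (count-containing {G = G} noEven v k)))
  where P = PerfectlyMatchableOfSize? G (2 * k)

mainTheorem2 : ∀ {n} (G : Graph n) → NoEvenCycles G →
    ((v w : Fin n) → Adj G v w →
       pmPoly G ≈P pmPoly (delEdge G v w) ⊕ z· pmPoly (delVertices2 G v w))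
    × ((v : Fin n) → v ∈ verts G →
       pmPoly G ≈P pmPoly (delVertex G v) ⊕ z· ΣP[ Adj? G v ∣ (λ w → pmPoly (delVertices2 G v w)) ])
mainTheorem2 G noEven = pmPoly-delEdge G noEven , λ v _ → pmPoly-delVertex G noEven v
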